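{- Let $n\ge 9$ be odd, let $s>0$ be an integer and $1\le i\le n$. Let $G_{n-1}$ be the complement of the disjoint union of two cycles each of length $(n-1)/2$. Then $\{s,2s,\dots,ns\}\setminus\{is\}$ is not a signature for $G_{n-1}$.
   Context: A finite simple graph $G=(V,E)$ has signature $S$ (a finite set of integers) if there is a bijection $\pi:S\to V$ such that for any two distinct $a,b\in S$, $\pi(a)$ and $\pi(b)$ are adjacent iff $|a-b|\in S$. -}

module Defs where

open import Level using (0ℓ)
open import Data.Nat using (ℕ; zero; suc; _+_; _*_; _∸_; _≤_; _<_)
open import Data.Fin using (Fin; toℕ)
open import Data.Integer using (ℤ; +_; _-_; ∣_∣)
open import Data.Product using (_×_; _,_; Σ; ∃; ∃-syntax; proj₁; proj₂)
open import Data.Sum using (_⊎_)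
open import Relation.Nullary using (¬_)
open import Relation.Binary.PropositionalEquality using (_≡_; _≢_)
open import Function.Bundles using (_⇔_)

record Graph : Set₁ where
  field
    V   : Set
    Adj : V → V → Set

open Graph public

-- The bijection is given as a map on (a , proof a ∈ S); injectivity and
-- surjectivity are stated on the integer component so that the (possibly
-- non-unique) membership proofs play no role.
record HasSignature (G : Graph) (S : ℤ → Set) : Set where
  field
    π    : (a : ℤ) → S a → V G
    inj  : ∀ a b (p : S a) (q : S b) → π a p ≡ π b q → a ≡ b
    surj : ∀ (v : V G) → ∃[ a ] Σ (S a) (λ p → π a p ≡ v)
    adj  : ∀ a b (p : S a) (q : S b) → a ≢ b →
           (Adj G (π a p) (π b q) ⇔ S (+ ∣ a - b ∣))

CycAdj : (k : ℕ) → Fin k → Fin k → Set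
CycAdj k p q = Step p q ⊎ Step q p
  where
  Step : Fin k → Fin k → Set
  Step x y = (toℕ y ≡ suc (toℕ x)) ⊎ ((toℕ x ≡ k ∸ 1) × (toℕ y ≡ 0))

TwoCycAdj : (k : ℕ) → Fin 2 × Fin k → Fin 2 × Fin k → Set
TwoCycAdj k (b , p) (c , q) = (b ≡ c) × CycAdj k p q

CoTwoCycles : ℕ → Graph
CoTwoCycles k = record
  { V   = Fin 2 × Fin k
  ; Adj = λ u v → (u ≢ v) × ¬ TwoCycAdj k u v }

SigSet : (n s i : ℕ) → ℤ → Set
SigSet n s i a = ∃[ j ] ((1 ≤ j) × (j ≤ n) × (j ≢ i) × (a ≡ + (j * s)))

module Submission where

-- Put n = 2k + 1 and r = i - 1, so the signature set
-- S = {s, 2s, …, ns} ∖ {is} has exactly 2k elements, the same number as the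
-- vertices of G = complement of 2·C_k.  Label the elements of S by t : Fin 2k,
-- the t-th element being  label t · s  with  label t = 1 + punchIn r t, i.e.
-- the multipliers 1, …, n skipping i in increasing order.  The map ι sending t
-- to the vertex π(label t · s) is injective, hence (by counting) a bijection.
-- Let v be the vertex of the smallest element  j₀ s  of S.  For every other
-- t we have label t > j₀, and ι t fails to be adjacent to v exactly when
-- (label t - j₀) s ∉ S, i.e. when label t = j₀ + i.  So v has at most one
-- non-neighbour besides itself; but in G every vertex has two distinct
-- non-neighbours, its neighbours on its own cycle (n ≥ 9 gives k ≥ 4; the
-- argument only needs k ≥ 3).

open import Defs
open import Data.Nat
  using (ℕ; suc; _+_; _*_; _∸_; _/_; _%_; _≤_; _<_; z≤n; s≤s; NonZero; >-nonZero; _≟_)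
import Data.Nat.Properties as ℕ
open import Data.Nat.DivMod using (m≡m%n+[m/n]*n)
open import Data.Fin using (Fin; toℕ; fromℕ; fromℕ<; inject₁; combine; punchIn)
  renaming (zero to fzero; suc to fsuc)
import Data.Fin.Properties as Fin
open import Data.Integer using (+_; _-_; ∣_∣; _⊖_)
import Data.Integer.Properties as ℤ
open import Data.Product using (_×_; _,_; ∃; ∃₂; proj₁; proj₂)
open import Data.Sum using (_⊎_; inj₁; inj₂)
open import Data.Empty using (⊥; ⊥-elim)
open import Relation.Nullary using (¬_; yes; no)
open import Relation.Binary.PropositionalEquality
  using (_≡_; _≢_; refl; sym; trans; cong; cong₂; subst; module ≡-Reasoning)
open import Function.Bundles using (Equivalence)
open import Function.Definitions using (Injective)

-- One step along the cycle C_k on positions: x → x + 1, or the wrap-around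
-- (k - 1) → 0.  By definition CycAdj k p q is
-- CycStep k (toℕ p) (toℕ q) ⊎ CycStep k (toℕ q) (toℕ p).
CycStep : ℕ → ℕ → ℕ → Set
CycStep k x y = (y ≡ suc x) ⊎ ((x ≡ k ∸ 1) × (y ≡ 0))

step-asymmetric : ∀ {k x y} → 3 ≤ k → CycStep k x y → ¬ CycStep k y x
step-asymmetric {x = x} _ (inj₁ refl) (inj₁ x≡2+x) = ℕ.m≢1+n+m x {1} x≡2+x
step-asymmetric (s≤s (s≤s (s≤s _))) (inj₁ refl) (inj₂ (() , refl))
step-asymmetric (s≤s (s≤s (s≤s _))) (inj₂ (refl , refl)) (inj₁ ())
step-asymmetric (s≤s (s≤s (s≤s _))) (inj₂ (refl , refl)) (inj₂ (() , _))

cycAdj-sym : ∀ {k} {p q : Fin k} → CycAdj k p q → CycAdj k q p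
cycAdj-sym (inj₁ step) = inj₂ step
cycAdj-sym (inj₂ step) = inj₁ step

cycAdj-irreflexive : ∀ {k} → 3 ≤ k → (x : Fin k) → ¬ CycAdj k x x
cycAdj-irreflexive 3≤k x (inj₁ step) = step-asymmetric 3≤k step step
cycAdj-irreflexive 3≤k x (inj₂ step) = step-asymmetric 3≤k step step

successor : ∀ {k} (x : Fin k) → ∃ λ (y : Fin k) → CycStep k (toℕ x) (toℕ y)
successor {k} x with suc (toℕ x) ≟ k
... | yes 1+x≡k = fromℕ< 0<k , inj₂ (cong (_∸ 1) 1+x≡k , Fin.toℕ-fromℕ< 0<k)
  where
  0<k : 0 < k
  0<k = ℕ.≤-trans (s≤s z≤n) (Fin.toℕ<n x)
... | no 1+x≢k = fromℕ< 1+x<k , inj₁ (Fin.toℕ-fromℕ< 1+x<k)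
  where
  1+x<k : suc (toℕ x) < k
  1+x<k = ℕ.≤∧≢⇒< (Fin.toℕ<n x) 1+x≢k

predecessor : ∀ {k} (x : Fin k) → ∃ λ (y : Fin k) → CycStep k (toℕ y) (toℕ x)
predecessor {suc k} fzero    = fromℕ k , inj₂ (Fin.toℕ-fromℕ k , refl)
predecessor {suc k} (fsuc x) = inject₁ x , inj₁ (cong suc (sym (Fin.toℕ-inject₁ x)))

cycle-neighbours : ∀ {k} → 3 ≤ k → (x : Fin k) →
                   ∃₂ λ (y z : Fin k) → CycAdj k x y × CycAdj k x z × y ≢ z
cycle-neighbours 3≤k x with successor x | predecessor x
... | y , x→y | z , z→x = y , z , inj₁ x→y , inj₂ z→x , y≢z
  where
  y≢z : y ≢ z
  y≢z refl = step-asymmetric 3≤k x→y z→x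

-- Counting: an injection of Fin m into itself is onto.  (Extend it by the
-- target value y at a new point; the pigeonhole collision must involve y.)
injective⇒surjective : ∀ {m} {f : Fin m → Fin m} → Injective _≡_ _≡_ f →
                       ∀ y → ∃ λ x → f x ≡ y
injective⇒surjective {m} {f} f-inj y with Fin.pigeonhole (ℕ.n<1+n m) extended
  where
  extended : Fin (suc m) → Fin m
  extended fzero    = y
  extended (fsuc x) = f x
... | fzero  , fsuc x , _   , y≡fx = x , sym y≡fx
... | fsuc a , fsuc b , a<b , fa≡fb = ⊥-elim (Fin.<-irrefl (cong fsuc (f-inj fa≡fb)) a<b)

injection-onto : ∀ {m} {A : Set} {e : A → Fin m} {f : Fin m → A} →
                 Injective _≡_ _≡_ e → Injective _≡_ _≡_ f → ∀ a → ∃ λ x → f x ≡ a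
injection-onto e-inj f-inj a with injective⇒surjective (λ eq → f-inj (e-inj eq)) _
... | x , efx≡ea = x , e-inj efx≡ea

multiple-injective : ∀ {a b s} .{{_ : NonZero s}} → + (a * s) ≡ + (b * s) → a ≡ b
multiple-injective {a} {b} {s} eq = ℕ.*-cancelʳ-≡ a b s (ℤ.+-injective eq)

multiple-distance : ∀ {a b} s → b ≤ a → + ∣ + (a * s) - + (b * s) ∣ ≡ + ((a ∸ b) * s)
multiple-distance {a} {b} s b≤a = begin
  + ∣ + (a * s) - + (b * s) ∣ ≡⟨ cong (λ z → + ∣ z ∣) (ℤ.[+m]-[+n]≡m⊖n (a * s) (b * s)) ⟩
  + ∣ a * s ⊖ b * s ∣         ≡⟨ cong (λ z → + ∣ z ∣) (ℤ.⊖-≥ (ℕ.*-monoˡ-≤ s b≤a)) ⟩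
  + (a * s ∸ b * s)           ≡⟨ cong +_ (sym (ℕ.*-distribʳ-∸ s a b)) ⟩
  + ((a ∸ b) * s)             ∎
  where open ≡-Reasoning

module NoSignature (k s : ℕ) .{{_ : NonZero s}} (3≤k : 3 ≤ k) (r : Fin (suc (2 * k)))
  (H : HasSignature (CoTwoCycles k) (SigSet (suc (2 * k)) s (suc (toℕ r)))) where

  open HasSignature H

  n i : ℕ
  n = suc (2 * k)
  i = suc (toℕ r)

  -- The multipliers 1, …, n other than i, in increasing order.
  label : Fin (2 * k) → ℕ
  label t = suc (toℕ (punchIn r t))

  label-injective : Injective _≡_ _≡_ label
  label-injective eq = Fin.punchIn-injective r _ _ (Fin.toℕ-injective (ℕ.suc-injective eq))

  -- A fixed membership proof for each labelled element; π may depend on the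
  -- proof, so working only with these makes ι below a function of t alone.
  label-in-S : ∀ t → SigSet n s i (+ (label t * s))
  label-in-S t = label t , s≤s z≤n , Fin.toℕ<n (punchIn r t) , label≢i , refl
    where
    label≢i : label t ≢ i
    label≢i eq = Fin.punchInᵢ≢i r t (Fin.toℕ-injective (ℕ.suc-injective eq))

  first : Fin (2 * k)
  first = fromℕ< (ℕ.≤-trans (s≤s z≤n) (ℕ.*-monoʳ-≤ 2 3≤k))

  -- punchIn r is strictly monotone, so the first index carries the smallest label.
  label-minimal : ∀ {t} → t ≢ first → label first < label t
  label-minimal {t} t≢first = s≤s (ℕ.≤∧≢⇒< first≤t first≢t)
    where
    first≤t : toℕ (punchIn r first) ≤ toℕ (punchIn r t)
    first≤t = Fin.punchIn-mono-≤ r first t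
                (subst (_≤ toℕ t) (sym (Fin.toℕ-fromℕ< _)) z≤n)
    first≢t : toℕ (punchIn r first) ≢ toℕ (punchIn r t)
    first≢t eq = t≢first (sym (Fin.punchIn-injective r _ _ (Fin.toℕ-injective eq)))

  ι : Fin (2 * k) → Fin 2 × Fin k
  ι t = π _ (label-in-S t)

  ι-injective : Injective _≡_ _≡_ ι
  ι-injective eq = label-injective (multiple-injective (inj _ _ _ _ eq))

  encode : Fin 2 × Fin k → Fin (2 * k)
  encode (b , x) = combine b x

  encode-injective : Injective _≡_ _≡_ encode
  encode-injective {b , x} {c , y} eq with Fin.combine-injective b x c y eq
  ... | b≡c , x≡y = cong₂ _,_ b≡c x≡y

  -- Both sides have 2k elements, so ι is a bijection.
  ι-onto : ∀ u → ∃ λ t → ι t ≡ u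
  ι-onto = injection-onto encode-injective ι-injective

  -- A vertex other than ι first and not adjacent to it has label  label first + i:
  -- otherwise the difference of labels d satisfies 1 ≤ d ≤ n, d ≠ i, so d·s ∈ S.
  non-neighbour-label : ∀ t → t ≢ first → ¬ Adj (CoTwoCycles k) (ι t) (ι first) →
                        label t ≡ label first + i
  non-neighbour-label t t≢first ¬adj with label t ∸ label first ≟ i
  ... | yes d≡i = trans (sym (ℕ.m+[n∸m]≡n (ℕ.<⇒≤ (label-minimal t≢first))))
                        (cong (λ d → label first + d) d≡i)
  ... | no d≢i = ⊥-elim (¬adj (Equivalence.from (adj _ _ _ _ distinct) distance-in-S))
    where
    first<t : label first < label t
    first<t = label-minimal t≢first
    distinct : + (label t * s) ≢ + (label first * s)
    distinct eq = t≢first (label-injective (multiple-injective eq))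
    distance-in-S : SigSet n s i (+ ∣ + (label t * s) - + (label first * s) ∣)
    distance-in-S = label t ∸ label first , ℕ.m<n⇒0<n∸m first<t
                  , ℕ.≤-trans (ℕ.m∸n≤m (label t) (label first)) (Fin.toℕ<n (punchIn r t)) , d≢i
                  , multiple-distance s (ℕ.<⇒≤ first<t)

  v : Fin 2 × Fin k
  v = ι first

  -- Each cycle neighbour of v is a non-neighbour of v in G, so it is the
  -- vertex with label  label first + i.
  cycle-neighbour-label : ∀ y → CycAdj k (proj₂ v) y →
                          ∃ λ t → ι t ≡ (proj₁ v , y) × label t ≡ label first + i
  cycle-neighbour-label y v~y with ι-onto (proj₁ v , y)
  ... | t , ιt≡u = t , ιt≡u , non-neighbour-label t t≢first ¬adj
    where
    t≢first : t ≢ first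
    t≢first refl = cycAdj-irreflexive 3≤k _ (subst (CycAdj k (proj₂ v)) (sym (cong proj₂ ιt≡u)) v~y)
    ¬adj : ¬ Adj (CoTwoCycles k) (ι t) v
    ¬adj (_ , ¬cycle) = ¬cycle (subst (λ u → TwoCycAdj k u v) (sym ιt≡u) (refl , cycAdj-sym v~y))

  impossible : ⊥
  impossible with cycle-neighbours 3≤k (proj₂ v)
  ... | y , z , v~y , v~z , y≢z with cycle-neighbour-label y v~y | cycle-neighbour-label z v~z
  ... | ty , ιty≡ , label-ty | tz , ιtz≡ , label-tz = y≢z (cong proj₂ (begin
    (proj₁ v , y) ≡⟨ sym ιty≡ ⟩
    ι ty          ≡⟨ cong ι (label-injective (trans label-ty (sym label-tz))) ⟩
    ι tz          ≡⟨ ιtz≡ ⟩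
    (proj₁ v , z) ∎))
    where open ≡-Reasoning

odd-half : ∀ n → n % 2 ≡ 1 → n ≡ suc (2 * (n / 2))
odd-half n odd = trans (m≡m%n+[m/n]*n n 2) (cong₂ _+_ odd (ℕ.*-comm (n / 2) 2))

half-lower-bound : ∀ k → 9 ≤ suc (2 * k) → 3 ≤ k
half-lower-bound k 9≤n = ℕ.*-cancelˡ-≤ 2 (ℕ.≤-trans (ℕ.m≤n+m 6 2) (ℕ.≤-pred 9≤n))

no-signature : ∀ k s → 3 ≤ k → 0 < s → ∀ i → 1 ≤ i → i ≤ suc (2 * k) →
               ¬ HasSignature (CoTwoCycles k) (SigSet (suc (2 * k)) s i)
no-signature k s 3≤k 0<s (suc i′) _ i≤n H =
  NoSignature.impossible k s {{>-nonZero 0<s}} 3≤k r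
    (subst (λ j → HasSignature (CoTwoCycles k) (SigSet (suc (2 * k)) s (suc j)))
           (sym (Fin.toℕ-fromℕ< i≤n)) H)
  where
  r : Fin (suc (2 * k))
  r = fromℕ< i≤n

lemma8 : (n : ℕ) → n % 2 ≡ 1 → 9 ≤ n → (s : ℕ) → 0 < s → (i : ℕ) → 1 ≤ i → i ≤ n →
    ¬ HasSignature (CoTwoCycles (n / 2)) (SigSet n s i)
lemma8 n odd 9≤n s 0<s i 1≤i i≤n =
  subst (λ m → 9 ≤ m → i ≤ m → ¬ HasSignature (CoTwoCycles (n / 2)) (SigSet m s i))
    (sym (odd-half n odd))
    (λ 9≤2k+1 → no-signature (n / 2) s (half-lower-bound (n / 2) 9≤2k+1) 0<s i 1≤i)
    9≤n i≤n
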